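{- For all formulas $A,B$: if $A\vdash B$ is not provable in $\mathbf{CNL_4^2}$, then there is a c-normal prime $\mathbf{CNL_4^2}$-theory $\alpha$ with $A\in\alpha$ and $B\notin\alpha$.
   Context: Formulas are built from a countable set $PV$ of variables with binary $\wedge,\vee$ and unary ${\sim}$; ${\sim}^{n}A$ denotes $n$-fold application of ${\sim}$. The calculus $\mathbf{CNL_4^2}$ (on sequents $A\vdash B$) has axiom schemata (a1) $A\wedge B\vdash A$; (a2) $A\wedge B\vdash B$; (a3) $B\vdash A\vee B$; (a4) $A\vdash A\vee B$; (a5) $A\vdash{\sim}^{4}A$; (a6) ${\sim}^{4}A\vdash A$; (a7) ${\sim}A\wedge{\sim}B\vdash{\sim}(A\wedge B)$; (a8) ${\sim}(A\vee B)\vdash{\sim}A\vee{\sim}B$; (a9) $A\wedge{\sim}^{2}A\vdash B$; (a10) $A\wedge(B\vee C)\vdash(A\wedge B)\vee(A\wedge C)$; (b1) ${\sim}(A\wedge B)\vdash{\sim}A\wedge{\sim}B$; (b2) ${\sim}A\vee{\sim}B\vdash{\sim}(A\vee B)$; and rules (r1) $A\vdash B$, $B\vdash C$ / $A\vdash C$; (r2) $A\vdash B$, $A\vdash C$ / $A\vdash B\wedge C$; (r3) $A\vdash C$, $B\vdash C$ / $A\vee B\vdash C$; (r4) $A\vdash B$ / ${\sim}^{2}B\vdash{\sim}^{2}A$. Provability: existence of a finite list of sequents, each an axiom or obtained from earlier ones by a rule, ending in the sequent. A $\mathbf{CNL_4^2}$-theory is a set $\alpha$ of formulas such that $A\wedge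 B\in\alpha$ whenever $A,B\in\alpha$, and $B\in\alpha$ whenever $A\in\alpha$ and $A\vdash B$ is provable. It is prime if $A\vee B\in\alpha$ implies $A\in\alpha$ or $B\in\alpha$. It is c-normal if for every formula $A$: $A\in\alpha$ iff ${\sim}^{2}A\notin\alpha$. -}

module Defs where

open import Data.Nat using (ℕ; zero; suc)
open import Data.Sum using (_⊎_)
open import Data.Empty using (⊥)
open import Relation.Nullary using (¬_)
open import Function.Bundles using (_⇔_)
open import Level using (Level; suc; _⊔_) renaming (zero to lzero)

data Formula : Set where
  var  : ℕ → Formula
  _∧_  : Formula → Formula → Formula
  _∨_  : Formula → Formula → Formula
  ∼_   : Formula → Formula

infixr 6 _∧_
infixr 5 _∨_
infix  7 ∼_

∼^ : ℕ → Formula → Formula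
∼^ zero    A = A
∼^ (suc n) A = ∼ (∼^ n A)

infix 3 _⊢_

data _⊢_ : Formula → Formula → Set where
  a1  : ∀ {A B} → A ∧ B ⊢ A
  a2  : ∀ {A B} → A ∧ B ⊢ B
  a3  : ∀ {A B} → B ⊢ A ∨ B
  a4  : ∀ {A B} → A ⊢ A ∨ B
  a5  : ∀ {A} → A ⊢ ∼^ 4 A
  a6  : ∀ {A} → ∼^ 4 A ⊢ A
  a7  : ∀ {A B} → ∼ A ∧ ∼ B ⊢ ∼ (A ∧ B)
  a8  : ∀ {A B} → ∼ (A ∨ B) ⊢ ∼ A ∨ ∼ B
  a9  : ∀ {A B} → A ∧ ∼^ 2 A ⊢ B
  a10 : ∀ {A B C} → A ∧ (B ∨ C) ⊢ (A ∧ B) ∨ (A ∧ C)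
  b1  : ∀ {A B} → ∼ (A ∧ B) ⊢ ∼ A ∧ ∼ B
  b2  : ∀ {A B} → ∼ A ∨ ∼ B ⊢ ∼ (A ∨ B)
  r1  : ∀ {A B C} → A ⊢ B → B ⊢ C → A ⊢ C
  r2  : ∀ {A B C} → A ⊢ B → A ⊢ C → A ⊢ B ∧ C
  r3  : ∀ {A B C} → A ⊢ C → B ⊢ C → A ∨ B ⊢ C
  r4  : ∀ {A B} → A ⊢ B → ∼^ 2 B ⊢ ∼^ 2 A

FormulaSet : (ℓ : Level) → Set (Level.suc ℓ)
FormulaSet ℓ = Formula → Set ℓ

record IsTheory {ℓ} (α : FormulaSet ℓ) : Set ℓ where
  field
    closed-∧ : ∀ {A B} → α A → α B → α (A ∧ B)
    closed-⊢ : ∀ {A B} → α A → A ⊢ B → α B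

IsPrime : ∀ {ℓ} → FormulaSet ℓ → Set ℓ
IsPrime α = ∀ {A B} → α (A ∨ B) → α A ⊎ α B

IsCNormal : ∀ {ℓ} → FormulaSet ℓ → Set ℓ
IsCNormal α = ∀ A → α A ⇔ (¬ α (∼^ 2 A))

{-# OPTIONS --safe #-}
-- A valuation gives independent truth values to each p and ∼p; ∼ then commutes
-- with ∧ and ∨, and ∼∼ acts as Boolean negation. The formulas true under a
-- valuation form a prime c-normal theory, so it suffices to find a valuation
-- making A true and B false. If there is none, A ⊢ B: by a Kalmár-style argument
-- the literals describing a valuation on the variables of A and B decide A and B,
-- and since C ⊢ P ∨ ∼∼P the case distinctions over all these valuations combine
-- into a derivation.
module Submission where

open import Defs
open import Data.Bool using (Bool; true; false; not; T) renaming (_∧_ to _∧ᵇ_; _∨_ to _∨ᵇ_)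
open import Data.Bool.Properties using (T-∧; T-∨; not-involutive; ∧-inverseʳ; ∧-distribˡ-∨)
open import Data.Empty using (⊥-elim)
open import Data.List using (List; []; _∷_; _++_)
open import Data.List.Membership.Propositional using (_∈_)
open import Data.List.Membership.Propositional.Properties using (∈-++⁺ˡ; ∈-++⁺ʳ)
open import Data.List.Relation.Unary.Any using (here; there)
open import Data.Nat using (ℕ; _≟_)
open import Data.Product using (Σ; _×_; _,_; proj₁; proj₂)
open import Data.Sum using (_⊎_; inj₁; inj₂; [_,_])
open import Function.Bundles using (_⇔_; mk⇔; Equivalence)
open import Level using (0ℓ)
open import Relation.Binary.PropositionalEquality using (_≡_; refl; sym; subst)
open import Relation.Nullary using (¬_; yes; no; contradiction)

open Equivalence using (to; from)

Valuation : Set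
Valuation = ℕ → Bool × Bool

mutual
  eval : Valuation → Formula → Bool
  eval v (var p) = proj₁ (v p)
  eval v (X ∧ Y) = eval v X ∧ᵇ eval v Y
  eval v (X ∨ Y) = eval v X ∨ᵇ eval v Y
  eval v (∼ X)   = eval∼ v X

  eval∼ : Valuation → Formula → Bool
  eval∼ v (var p) = proj₂ (v p)
  eval∼ v (X ∧ Y) = eval∼ v X ∧ᵇ eval∼ v Y
  eval∼ v (X ∨ Y) = eval∼ v X ∨ᵇ eval∼ v Y
  eval∼ v (∼ X)   = not (eval v X)

Sat : Valuation → FormulaSet 0ℓ
Sat v C = T (eval v C)

T-not-antitone : ∀ {x y} → (T x → T y) → T (not y) → T (not x)
T-not-antitone {false}         _ _  = _
T-not-antitone {true}  {true}  _ ()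
T-not-antitone {true}  {false} f _  = f _

T⇔¬T-not : ∀ x → T x ⇔ (¬ T (not x))
T⇔¬T-not true  = mk⇔ (λ _ ()) (λ _ → _)
T⇔¬T-not false = mk⇔ (λ ()) (λ ¬T-true → ¬T-true _)

sound : ∀ v {A B} → A ⊢ B → Sat v A → Sat v B
sound v a1 h = proj₁ (to T-∧ h)
sound v a2 h = proj₂ (to T-∧ h)
sound v a3 h = from T-∨ (inj₂ h)
sound v a4 h = from T-∨ (inj₁ h)
sound v {A} a5 h = subst T (sym (not-involutive (eval v A))) h
sound v {_} {B} a6 h = subst T (not-involutive (eval v B)) h
sound v a7 h = h
sound v a8 h = h
sound v {A ∧ _} a9 h = ⊥-elim (subst T (∧-inverseʳ (eval v A)) h)
sound v {A ∧ (B ∨ C)} a10 h = subst T (∧-distribˡ-∨ (eval v A) (eval v B) (eval v C)) h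
sound v b1 h = h
sound v b2 h = h
sound v (r1 d e) h = sound v e (sound v d h)
sound v (r2 d e) h = from T-∧ (sound v d h , sound v e h)
sound v (r3 d e) h = [ sound v d , sound v e ] (to T-∨ h)
sound v (r4 d) h = T-not-antitone (sound v d) h

Sat-isTheory : ∀ v → IsTheory (Sat v)
Sat-isTheory v = record
  { closed-∧ = λ hA hB → from T-∧ (hA , hB)
  ; closed-⊢ = λ h d → sound v d h
  }

Sat-isPrime : ∀ v → IsPrime (Sat v)
Sat-isPrime v {A} = to (T-∨ {eval v A})

Sat-isCNormal : ∀ v → IsCNormal (Sat v)
Sat-isCNormal v C = T⇔¬T-not (eval v C)

⊢-refl : ∀ {A} → A ⊢ A
⊢-refl = r1 a5 a6

∼²-∨-intro : ∀ {X Y} → ∼^ 2 X ∧ ∼^ 2 Y ⊢ ∼^ 2 (X ∨ Y)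
∼²-∨-intro = r1 a5 (r4 (r3 (r1 a5 (r4 a1)) (r1 a5 (r4 a2))))

excluded-middle : ∀ {C P} → C ⊢ P ∨ ∼^ 2 P
excluded-middle {C} {P} = r1 a5 (r1 (r4 refutation) a6)
  where
  -- ∼∼(P ∨ ∼∼P) gives both ∼∼P and ∼∼∼∼P, which explode by a9; contrapose with r4.
  refutation : ∼^ 2 (P ∨ ∼^ 2 P) ⊢ ∼^ 2 C
  refutation = r1 (r2 (r4 a4) (r4 a3)) a9

⊢-cases : ∀ {G P A B} → (G ∧ P) ∧ A ⊢ B → (G ∧ ∼^ 2 P) ∧ A ⊢ B → G ∧ A ⊢ B
⊢-cases d e = r1 (r2 ⊢-refl excluded-middle) (r1 a10 (r3 (r1 swap d) (r1 swap e)))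
  where
  swap : ∀ {G A P} → (G ∧ A) ∧ P ⊢ (G ∧ P) ∧ A
  swap = r2 (r2 (r1 a1 a1) a2) (r1 a1 a2)

signed : Bool → Formula → Formula
signed true  C = C
signed false C = ∼^ 2 C

signed-∧ : ∀ {G X Y} b c → G ⊢ signed b X → G ⊢ signed c Y → G ⊢ signed (b ∧ᵇ c) (X ∧ Y)
signed-∧ true  true  p q = r2 p q
signed-∧ true  false p q = r1 q (r4 a2)
signed-∧ false c     p q = r1 p (r4 a1)

signed-∼∧ : ∀ {G X Y} b c → G ⊢ signed b (∼ X) → G ⊢ signed c (∼ Y) →
            G ⊢ signed (b ∧ᵇ c) (∼ (X ∧ Y))
signed-∼∧ true  true  p q = r1 (r2 p q) a7
signed-∼∧ true  false p q = r1 q (r4 (r1 b1 a2))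
signed-∼∧ false c     p q = r1 p (r4 (r1 b1 a1))

signed-∨ : ∀ {G X Y} b c → G ⊢ signed b X → G ⊢ signed c Y → G ⊢ signed (b ∨ᵇ c) (X ∨ Y)
signed-∨ true  c     p q = r1 p a4
signed-∨ false true  p q = r1 q a3
signed-∨ false false p q = r1 (r2 p q) ∼²-∨-intro

signed-∼∨ : ∀ {G X Y} b c → G ⊢ signed b (∼ X) → G ⊢ signed c (∼ Y) →
            G ⊢ signed (b ∨ᵇ c) (∼ (X ∨ Y))
signed-∼∨ true  c     p q = r1 p (r1 a4 b2)
signed-∼∨ false true  p q = r1 q (r1 a3 b2)
signed-∼∨ false false p q = r1 (r2 p q) (r1 ∼²-∨-intro (r4 a8))

signed-∼∼ : ∀ {G X} b → G ⊢ signed b X → G ⊢ signed (not b) (∼ ∼ X)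
signed-∼∼ true  p = r1 p a5
signed-∼∼ false p = p

vars : Formula → List ℕ
vars (var p) = p ∷ []
vars (X ∧ Y) = vars X ++ vars Y
vars (X ∨ Y) = vars X ++ vars Y
vars (∼ X)   = vars X

Settles : Formula → Valuation → ℕ → Set
Settles G v q = (G ⊢ signed (proj₁ (v q)) (var q)) × (G ⊢ signed (proj₂ (v q)) (∼ var q))

-- A record rather than a function type, so that G and v are inferable from it.
record _settles_on_ (G : Formula) (v : Valuation) (L : List ℕ) : Set where
  constructor settling
  field settles : ∀ {q} → q ∈ L → Settles G v q
open _settles_on_

settles-++ˡ : ∀ {G v K} L → G settles v on (K ++ L) → G settles v on K
settles-++ˡ L s = settling (λ q∈K → settles s (∈-++⁺ˡ q∈K))

settles-++ʳ : ∀ {G v L} K → G settles v on (K ++ L) → G settles v on L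
settles-++ʳ K s = settling (λ q∈L → settles s (∈-++⁺ʳ K q∈L))

mutual
  kalmar : ∀ {G v} C → G settles v on vars C → G ⊢ signed (eval v C) C
  kalmar (var p) s = proj₁ (settles s (here refl))
  kalmar {v = v} (X ∧ Y) s = signed-∧ (eval v X) (eval v Y)
    (kalmar X (settles-++ˡ (vars Y) s)) (kalmar Y (settles-++ʳ (vars X) s))
  kalmar {v = v} (X ∨ Y) s = signed-∨ (eval v X) (eval v Y)
    (kalmar X (settles-++ˡ (vars Y) s)) (kalmar Y (settles-++ʳ (vars X) s))
  kalmar (∼ X) s = kalmar∼ X s

  kalmar∼ : ∀ {G v} C → G settles v on vars C → G ⊢ signed (eval∼ v C) (∼ C)
  kalmar∼ (var p) s = proj₂ (settles s (here refl))
  kalmar∼ {v = v} (X ∧ Y) s = signed-∼∧ (eval∼ v X) (eval∼ v Y)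
    (kalmar∼ X (settles-++ˡ (vars Y) s)) (kalmar∼ Y (settles-++ʳ (vars X) s))
  kalmar∼ {v = v} (X ∨ Y) s = signed-∼∨ (eval∼ v X) (eval∼ v Y)
    (kalmar∼ X (settles-++ˡ (vars Y) s)) (kalmar∼ Y (settles-++ʳ (vars X) s))
  kalmar∼ {v = v} (∼ X) s = signed-∼∼ (eval v X) (kalmar X s)

_[_↦_] : Valuation → ℕ → Bool × Bool → Valuation
(v [ p ↦ bc ]) q with q ≟ p
... | yes _ = bc
... | no  _ = v q

Countermodel : Formula → Formula → Set
Countermodel A B = Σ Valuation λ v → Sat v A × ¬ Sat v B

module _ {A B : Formula} where

  falsified-or-⊢ : ∀ {G} a b → G ⊢ signed a A → G ⊢ signed b B → (T a × ¬ T b) ⊎ (G ∧ A ⊢ B)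
  falsified-or-⊢ true  false _    _  = inj₁ (_ , λ ())
  falsified-or-⊢ a     true  _    ⊢B = inj₂ (r1 a1 ⊢B)
  falsified-or-⊢ false false ⊢∼²A _ = inj₂ (r1 (r2 a2 (r1 a1 ⊢∼²A)) a9)

  countermodel-or-⊢-settled : ∀ {G v} → G settles v on (vars A ++ vars B) →
                              Countermodel A B ⊎ (G ∧ A ⊢ B)
  countermodel-or-⊢-settled {v = v} s
    with falsified-or-⊢ (eval v A) (eval v B) (kalmar A (settles-++ˡ (vars B) s))
                                              (kalmar B (settles-++ʳ (vars A) s))
  ... | inj₁ (⊨A , ⊭B) = inj₁ (v , ⊨A , ⊭B)
  ... | inj₂ d = inj₂ d

  by-cases : ∀ {G P} → Countermodel A B ⊎ ((G ∧ P) ∧ A ⊢ B) →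
             Countermodel A B ⊎ ((G ∧ ∼^ 2 P) ∧ A ⊢ B) → Countermodel A B ⊎ (G ∧ A ⊢ B)
  by-cases (inj₁ m) _        = inj₁ m
  by-cases _        (inj₁ m) = inj₁ m
  by-cases (inj₂ d) (inj₂ e) = inj₂ (⊢-cases d e)

  -- The formula G records the literals chosen so far; L lists the variables still to be settled.
  search : ∀ L G v → (∀ {q} → q ∈ vars A ++ vars B → q ∈ L ⊎ Settles G v q) →
           Countermodel A B ⊎ (G ∧ A ⊢ B)
  search [] G v inv = countermodel-or-⊢-settled {v = v} (settling settled)
    where
    settled : ∀ {q} → q ∈ vars A ++ vars B → Settles G v q
    settled q∈ with inv q∈
    ... | inj₁ ()
    ... | inj₂ s = s
  search (p ∷ L) G v inv =
    by-cases (by-cases (extend true true) (extend true false))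
             (by-cases (extend false true) (extend false false))
    where
    G′ : Bool → Bool → Formula
    G′ b c = (G ∧ signed b (var p)) ∧ signed c (∼ var p)

    inv′ : ∀ b c {q} → q ∈ vars A ++ vars B → q ∈ L ⊎ Settles (G′ b c) (v [ p ↦ (b , c) ]) q
    inv′ b c {q} q∈ with q ≟ p
    ... | yes refl = inj₂ (r1 a1 a2 , a2)
    ... | no q≢p with inv q∈
    ...   | inj₁ (here q≡p)    = contradiction q≡p q≢p
    ...   | inj₁ (there q∈L)   = inj₁ q∈L
    ...   | inj₂ (⊢lit , ⊢∼lit) = inj₂ (r1 (r1 a1 a1) ⊢lit , r1 (r1 a1 a1) ⊢∼lit)

    extend : ∀ b c → Countermodel A B ⊎ (G′ b c ∧ A ⊢ B)
    extend b c = search L (G′ b c) (v [ p ↦ (b , c) ]) (inv′ b c)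

countermodel-or-⊢ : ∀ A B → Countermodel A B ⊎ (A ⊢ B)
countermodel-or-⊢ A B with search (vars A ++ vars B) A (λ _ → true , true) inj₁
... | inj₁ m = inj₁ m
... | inj₂ d = inj₂ (r1 (r2 ⊢-refl ⊢-refl) d)

mainTheorem6 : ∀ (A B : Formula) → ¬ (A ⊢ B) →
    Σ (FormulaSet 0ℓ) (λ α → IsTheory α × IsPrime α × IsCNormal α × α A × ¬ α B)
mainTheorem6 A B A⊬B with countermodel-or-⊢ A B
... | inj₁ (v , ⊨A , ⊭B) =
  Sat v , Sat-isTheory v , (λ {C D} → Sat-isPrime v {C} {D}) , Sat-isCNormal v , ⊨A , ⊭B
... | inj₂ A⊢B = contradiction A⊢B A⊬B
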